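{- If $P_1$ and $P_2$ are (loopless) polymatroids, then the minimal multisymmetric lift of $P_1\oplus P_2$ equals $\widetilde P_1\oplus\widetilde P_2$, where $\widetilde P_j$ is the minimal multisymmetric lift of $P_j$.
   Context: A polymatroid on a finite set $E$ is a function $\mathrm{rk}:2^E\to\mathbb Z_{\ge0}$ that is submodular, monotone, $\mathrm{rk}(\emptyset)=0$, and loopless. The direct sum of polymatroids $P_1,P_2$ on $E^1,E^2$ is the polymatroid $P_1\oplus P_2$ on $E^1\sqcup E^2$ with $\mathrm{rk}(S)=\mathrm{rk}_{P_1}(S\cap E^1)+\mathrm{rk}_{P_2}(S\cap E^2)$. For a polymatroid $P$ on $E=\{1,\dots,n\}$, its minimal multisymmetric lift $\widetilde P$ is the matroid on $\widetilde E=\widetilde E_1\sqcup\cdots\sqcup\widetilde E_n$, $\widetilde E_i=\{1,\dots,\mathrm{rk}_P(i)\}$ (disjoint), with partition into the blocks $\widetilde E_i$ and rank function $\mathrm{rk}_{\widetilde P}(S)=\min_{A\subseteq E}(\mathrm{rk}_P(A)+|S\setminus\bigcup_{i\in A}\widetilde E_i|)$; it is characterized up to isomorphism (compatible with the block partition) as the unique matroid $M$ on such a partitioned set with $\mathrm{rk}_M(\bigcup_{i\in A}\widetilde E_i)=\mathrm{rk}_P(A)$ for all $A$, $\mathrm{rk}_M(\widetilde E_i)=|\widetilde E_i|$, and whose flats are mapped to flats by $\prod_i\mathfrak S_{\widetilde E_i}$. The equality is as matroids on $\widetilde{E^1}\sqcup\widetilde{E^2}$ with the combined block partition. -}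

module Defs where

open import Data.Nat using (ℕ; zero; suc; _+_; _≤_; _<_; _⊓_)
open import Data.Bool using (Bool; true; false; if_then_else_)
open import Data.Fin using (Fin; zero; suc; _↑ˡ_; _↑ʳ_)
open import Data.Fin.Subset using (Subset; ⊥; ⁅_⁆; _⊆_; _∪_; _∩_; ∣_∣; inside; outside)
open import Data.Vec using (Vec; []; _∷_; take; drop; lookup; tabulate; replicate)
import Data.Vec as Vec
open import Data.Vec using (sum)
open import Relation.Binary.PropositionalEquality using (_≡_; refl; cong; trans)

record IsPolymatroid {n : ℕ} (rk : Subset n → ℕ) : Set where
  field
    rk-∅        : rk ⊥ ≡ 0
    monotone    : ∀ {A B} → A ⊆ B → rk A ≤ rk B
    submodular  : ∀ A B → rk (A ∪ B) + rk (A ∩ B) ≤ rk A + rk B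
    loopless    : ∀ i → 0 < rk ⁅ i ⁆

-- Direct sum: ground set Fin (n₁ + n₂) = E¹ ⊔ E² (E¹ via _↑ˡ_, E² via _↑ʳ_).

_⊕_ : ∀ {n₁ n₂} → (Subset n₁ → ℕ) → (Subset n₂ → ℕ) → Subset (n₁ + n₂) → ℕ
_⊕_ {n₁} rk₁ rk₂ S = rk₁ (take n₁ S) + rk₂ (drop n₁ S)

minSub : ∀ {n} → (Subset n → ℕ) → ℕ
minSub {zero}  f = f []
minSub {suc n} f = minSub (λ A → f (outside ∷ A)) ⊓ minSub (λ A → f (inside ∷ A))

-- Minimal multisymmetric lift.
-- Ground set  Ẽ = ⊔_i Ẽ_i  with block  Ẽ_i = Fin (rk {i}).
-- A subset S ⊆ Ẽ is given blockwise: S i ⊆ Ẽ_i.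

block : ∀ {n} → (Subset n → ℕ) → Fin n → ℕ
block rk i = rk ⁅ i ⁆

LiftSubset : ∀ {n} → (Subset n → ℕ) → Set
LiftSubset {n} rk = (i : Fin n) → Subset (block rk i)

outsideCount : ∀ {n} (rk : Subset n → ℕ) → LiftSubset rk → Subset n → ℕ
outsideCount rk S A = sum (tabulate (λ i → if lookup A i then 0 else ∣ S i ∣))

liftRank : ∀ {n} (rk : Subset n → ℕ) → LiftSubset rk → ℕ
liftRank rk S = minSub (λ A → rk A + outsideCount rk S A)

take-⁅↑ˡ⁆ : ∀ {n₁} n₂ (i : Fin n₁) → take n₁ {n₂} ⁅ i ↑ˡ n₂ ⁆ ≡ ⁅ i ⁆
take-⁅↑ˡ⁆ n₂ zero = cong (inside ∷_) (take-⊥ _)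
  where
  take-⊥ : ∀ m {k} → take m {k} ⊥ ≡ ⊥
  take-⊥ zero = refl
  take-⊥ (suc m) = cong (outside ∷_) (take-⊥ m)
take-⁅↑ˡ⁆ n₂ (suc i) = cong (outside ∷_) (take-⁅↑ˡ⁆ n₂ i)

drop-⁅↑ˡ⁆ : ∀ {n₁} n₂ (i : Fin n₁) → drop n₁ {n₂} ⁅ i ↑ˡ n₂ ⁆ ≡ ⊥
drop-⁅↑ˡ⁆ {suc n₁} n₂ zero = drop-⊥ n₁
  where
  drop-⊥ : ∀ m {k} → drop m {k} ⊥ ≡ ⊥
  drop-⊥ zero = refl
  drop-⊥ (suc m) {k} = drop-⊥ m {k}
drop-⁅↑ˡ⁆ n₂ (suc i) = drop-⁅↑ˡ⁆ n₂ i

take-⁅↑ʳ⁆ : ∀ n₁ {n₂} (j : Fin n₂) → take n₁ ⁅ n₁ ↑ʳ j ⁆ ≡ ⊥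
take-⁅↑ʳ⁆ zero j = refl
take-⁅↑ʳ⁆ (suc n₁) j = cong (outside ∷_) (take-⁅↑ʳ⁆ n₁ j)

drop-⁅↑ʳ⁆ : ∀ n₁ {n₂} (j : Fin n₂) → drop n₁ ⁅ n₁ ↑ʳ j ⁆ ≡ ⁅ j ⁆
drop-⁅↑ʳ⁆ zero j = refl
drop-⁅↑ʳ⁆ (suc n₁) j = drop-⁅↑ʳ⁆ n₁ j

module _ {n₁ n₂} {rk₁ : Subset n₁ → ℕ} {rk₂ : Subset n₂ → ℕ}
         (P₁ : IsPolymatroid rk₁) (P₂ : IsPolymatroid rk₂) where

  block-left : ∀ i → block (rk₁ ⊕ rk₂) (i ↑ˡ n₂) ≡ block rk₁ i
  block-left i rewrite take-⁅↑ˡ⁆ n₂ i | drop-⁅↑ˡ⁆ n₂ i | IsPolymatroid.rk-∅ P₂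
    = Data.Nat.Properties.+-identityʳ _
    where import Data.Nat.Properties

  block-right : ∀ j → block (rk₁ ⊕ rk₂) (n₁ ↑ʳ j) ≡ block rk₂ j
  block-right j rewrite take-⁅↑ʳ⁆ n₁ j | drop-⁅↑ʳ⁆ n₁ j | IsPolymatroid.rk-∅ P₁ = refl

  -- Restriction of a subset of the lift of P₁ ⊕ P₂ to the blocks coming from E¹ / E²
  -- (elements of Ẽ_i are {1..rk(i)} in both, so the identification is the identity,
  -- up to the propositional equality of block sizes).
  restrictˡ : LiftSubset (rk₁ ⊕ rk₂) → LiftSubset rk₁
  restrictˡ S i = Vec.cast (block-left i) (S (i ↑ˡ n₂))

  restrictʳ : LiftSubset (rk₁ ⊕ rk₂) → LiftSubset rk₂
  restrictʳ S j = Vec.cast (block-right j) (S (n₁ ↑ʳ j))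

{-# OPTIONS --safe #-}
module Submission where

-- A subset of E¹ ⊔ E² is a pair A₁ ⊔ A₂, and on such a pair the objective
-- rk(A) + |S ∖ ⋃_{i∈A} Ẽ_i| of the lift's rank formula is a sum of a term in A₁
-- and a term in A₂, namely the objectives for P₁ and P₂. Minimising a separable
-- sum over a product minimises each summand separately.

open import Defs
open import Data.Nat using (ℕ; zero; suc; _+_; _⊓_)
open import Data.Nat.Properties using (+-distribˡ-⊓; +-distribʳ-⊓; +-commutativeSemigroup)
open import Algebra.Properties.CommutativeSemigroup +-commutativeSemigroup using (interchange)
open import Data.Bool using (if_then_else_)
open import Data.Fin using (Fin; zero; suc; _↑ˡ_; _↑ʳ_)
open import Data.Fin.Subset using (Subset; ∣_∣; inside; outside)
open import Data.Vec using (Vec; _∷_; _++_; take; drop; tabulate; lookup; sum; cast)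
open import Data.Vec.Properties
  using (sum-++; lookup-++ˡ; lookup-++ʳ; tabulate-cong; take++drop≡id; ++-injective; cast-is-id)
open import Data.Product using (proj₁; proj₂)
open import Relation.Binary.PropositionalEquality
  using (_≡_; refl; sym; trans; cong; cong₂; module ≡-Reasoning)

minSub-cong : ∀ {n} {f g : Subset n → ℕ} → (∀ A → f A ≡ g A) → minSub f ≡ minSub g
minSub-cong {zero}  f≗g = f≗g _
minSub-cong {suc n} f≗g =
  cong₂ _⊓_ (minSub-cong (λ A → f≗g (outside ∷ A))) (minSub-cong (λ A → f≗g (inside ∷ A)))

minSub-++ : ∀ {n₁ n₂} (f : Subset (n₁ + n₂) → ℕ) →
  minSub f ≡ minSub {n₁} (λ A₁ → minSub {n₂} (λ A₂ → f (A₁ ++ A₂)))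
minSub-++ {zero}  f = refl
minSub-++ {suc n₁} f =
  cong₂ _⊓_ (minSub-++ {n₁} (λ A → f (outside ∷ A))) (minSub-++ {n₁} (λ A → f (inside ∷ A)))

minSub-+ˡ : ∀ {n} c (f : Subset n → ℕ) → minSub (λ A → c + f A) ≡ c + minSub f
minSub-+ˡ {zero}  c f = refl
minSub-+ˡ {suc n} c f = trans
  (cong₂ _⊓_ (minSub-+ˡ c (λ A → f (outside ∷ A))) (minSub-+ˡ c (λ A → f (inside ∷ A))))
  (sym (+-distribˡ-⊓ c _ _))

minSub-+ʳ : ∀ {n} c (f : Subset n → ℕ) → minSub (λ A → f A + c) ≡ minSub f + c
minSub-+ʳ {zero}  c f = refl
minSub-+ʳ {suc n} c f = trans
  (cong₂ _⊓_ (minSub-+ʳ c (λ A → f (outside ∷ A))) (minSub-+ʳ c (λ A → f (inside ∷ A))))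
  (sym (+-distribʳ-⊓ c _ _))

minSub-separable : ∀ {n₁ n₂} (f : Subset n₁ → ℕ) (g : Subset n₂ → ℕ) →
  minSub (λ A₁ → minSub (λ A₂ → f A₁ + g A₂)) ≡ minSub f + minSub g
minSub-separable f g = trans
  (minSub-cong (λ A₁ → minSub-+ˡ (f A₁) g))
  (minSub-+ʳ (minSub g) f)

take-++ : ∀ {A : Set} m {n} (xs : Vec A m) (ys : Vec A n) → take m (xs ++ ys) ≡ xs
take-++ m xs ys = proj₁ (++-injective _ xs (take++drop≡id m (xs ++ ys)))

drop-++ : ∀ {A : Set} m {n} (xs : Vec A m) (ys : Vec A n) → drop m (xs ++ ys) ≡ ys
drop-++ m xs ys = proj₂ (++-injective _ xs (take++drop≡id m (xs ++ ys)))

tabulate-++ : ∀ {A : Set} n₁ {n₂} (f : Fin (n₁ + n₂) → A) →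
  tabulate f ≡ tabulate (λ i → f (i ↑ˡ n₂)) ++ tabulate (λ j → f (n₁ ↑ʳ j))
tabulate-++ zero    f = refl
tabulate-++ (suc n₁) f = cong (f zero ∷_) (tabulate-++ n₁ (λ i → f (suc i)))

∣cast∣ : ∀ {m n} (eq : m ≡ n) (p : Subset m) → ∣ cast eq p ∣ ≡ ∣ p ∣
∣cast∣ refl p = cong ∣_∣ (cast-is-id refl p)

⊕-++ : ∀ {n₁ n₂} (rk₁ : Subset n₁ → ℕ) (rk₂ : Subset n₂ → ℕ) A₁ A₂ →
  (rk₁ ⊕ rk₂) (A₁ ++ A₂) ≡ rk₁ A₁ + rk₂ A₂
⊕-++ {n₁} rk₁ rk₂ A₁ A₂ = cong₂ _+_ (cong rk₁ (take-++ n₁ A₁ A₂)) (cong rk₂ (drop-++ n₁ A₁ A₂))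

module _ {n₁ n₂} {rk₁ : Subset n₁ → ℕ} {rk₂ : Subset n₂ → ℕ}
         (P₁ : IsPolymatroid rk₁) (P₂ : IsPolymatroid rk₂) (S : LiftSubset (rk₁ ⊕ rk₂)) where

  outsideCount-++ : ∀ A₁ A₂ →
    outsideCount (rk₁ ⊕ rk₂) S (A₁ ++ A₂)
      ≡ outsideCount rk₁ (restrictˡ P₁ P₂ S) A₁ + outsideCount rk₂ (restrictʳ P₁ P₂ S) A₂
  outsideCount-++ A₁ A₂ = trans
    (cong sum (tabulate-++ n₁ _))
    (trans (sum-++ (tabulate {n = n₁} _)) (cong₂ _+_ (cong sum (tabulate-cong left)) (cong sum (tabulate-cong right))))
    where
    left : ∀ i → (if lookup (A₁ ++ A₂) (i ↑ˡ n₂) then 0 else ∣ S (i ↑ˡ n₂) ∣)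
               ≡ (if lookup A₁ i then 0 else ∣ restrictˡ P₁ P₂ S i ∣)
    left i = cong₂ (λ b k → if b then 0 else k)
      (lookup-++ˡ A₁ A₂ i) (sym (∣cast∣ (block-left P₁ P₂ i) (S (i ↑ˡ n₂))))
    right : ∀ j → (if lookup (A₁ ++ A₂) (n₁ ↑ʳ j) then 0 else ∣ S (n₁ ↑ʳ j) ∣)
                ≡ (if lookup A₂ j then 0 else ∣ restrictʳ P₁ P₂ S j ∣)
    right j = cong₂ (λ b k → if b then 0 else k)
      (lookup-++ʳ A₁ A₂ j) (sym (∣cast∣ (block-right P₁ P₂ j) (S (n₁ ↑ʳ j))))

lemma2p13 : ∀ {n₁ n₂} {rk₁ : Subset n₁ → ℕ} {rk₂ : Subset n₂ → ℕ}
    (P₁ : IsPolymatroid rk₁) (P₂ : IsPolymatroid rk₂) (S : LiftSubset (rk₁ ⊕ rk₂)) →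
    liftRank (rk₁ ⊕ rk₂) S ≡ liftRank rk₁ (restrictˡ P₁ P₂ S) + liftRank rk₂ (restrictʳ P₁ P₂ S)
lemma2p13 {n₁} {n₂} {rk₁} {rk₂} P₁ P₂ S = begin
  liftRank (rk₁ ⊕ rk₂) S                                            ≡⟨ minSub-++ {n₁} objective ⟩
  minSub {n₁} (λ A₁ → minSub {n₂} (λ A₂ → objective (A₁ ++ A₂)))   ≡⟨ minSub-cong (λ A₁ → minSub-cong (objective-++ A₁)) ⟩
  minSub (λ A₁ → minSub (λ A₂ → objective₁ A₁ + objective₂ A₂))  ≡⟨ minSub-separable objective₁ objective₂ ⟩
  liftRank rk₁ S₁ + liftRank rk₂ S₂                                 ∎
  where
  open ≡-Reasoning
  S₁ : LiftSubset rk₁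
  S₁ = restrictˡ P₁ P₂ S
  S₂ : LiftSubset rk₂
  S₂ = restrictʳ P₁ P₂ S
  objective : Subset (n₁ + n₂) → ℕ
  objective A = (rk₁ ⊕ rk₂) A + outsideCount (rk₁ ⊕ rk₂) S A
  objective₁ : Subset n₁ → ℕ
  objective₁ A₁ = rk₁ A₁ + outsideCount rk₁ S₁ A₁
  objective₂ : Subset n₂ → ℕ
  objective₂ A₂ = rk₂ A₂ + outsideCount rk₂ S₂ A₂
  objective-++ : ∀ (A₁ : Subset n₁) (A₂ : Subset n₂) → objective (A₁ ++ A₂) ≡ objective₁ A₁ + objective₂ A₂
  objective-++ A₁ A₂ = trans
    (cong₂ _+_ (⊕-++ rk₁ rk₂ A₁ A₂) (outsideCount-++ P₁ P₂ S A₁ A₂))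
    (interchange (rk₁ A₁) (rk₂ A₂) (outsideCount rk₁ S₁ A₁) (outsideCount rk₂ S₂ A₂))
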